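{- For each pair (logic $\mathbf{X}$, calculus $\mathbf{G3X}$) in the correspondence listed in the context, every axiom of the axiomatic system $\mathbf{X}$ (every instance of a propositional tautology, and every instance of each of the axiom schemes among $M$, $C$, $N$, $D^\bot$, $D^\Diamond$ that belong to $\mathbf{X}$) is derivable in $\mathbf{G3X}$, i.e. for every such axiom $A$ the sequent $\Rightarrow A$ is derivable in $\mathbf{G3X}$.
   Context: Formulas are generated from countably many propositional variables $p_0,p_1,\dots$ and the $0$-ary constant $\bot$ by the binary connectives $\wedge,\vee,\supset$ and the unary operator $\Box$; $\neg A:=A\supset\bot$, $\top:=\bot\supset\bot$, $A\leftrightarrow B:=(A\supset B)\wedge(B\supset A)$, $\Diamond A:=\neg\Box\neg A$. Axiomatic systems: $\mathbf{L}$ has as axioms all instances (in this language) of propositional tautologies and modus ponens as rule; $\mathbf{E}$ is $\mathbf{L}$ plus the rule $RE$: from $A\leftrightarrow B$ infer $\Box A\leftrightarrow\Box B$. Axiom schemes: $M$: $\Box(A\wedge B)\supset(\Box A\wedge\Box B)$; $C$: $(\Box A\wedge\Box B)\supset\Box(A\wedge B)$; $N$: $\Box\top$; $D^\bot$: $\neg\Box\bot$; $D^\Diamond$: $\Box A\supset\Diamond A$. Logics and corresponding calculi: $\mathbf{E}$ ($\mathbf{G3E}$); $\mathbf{E}\oplus N$ ($\mathbf{G3EN}$); $\mathbf{E}\oplus M$ ($\mathbf{G3M}$); $\mathbf{E}\oplus M\oplus N$ ($\mathbf{G3MN}$); $\mathbf{E}\oplus C$ ($\mathbf{G3C}$); $\mathbf{E}\oplus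 C\oplus N$ ($\mathbf{G3CN}$); $\mathbf{E}\oplus M\oplus C$ ($\mathbf{G3R}$); $\mathbf{E}\oplus M\oplus C\oplus N$ ($\mathbf{G3K}$); and, for $\mathbf{Y}$ one of these modal logics with calculus $\mathbf{G3Y}$: $\mathbf{Y}\oplus D^\bot$ corresponds to $\mathbf{G3YD^\bot}$, $\mathbf{Y}\oplus D^\Diamond$ to $\mathbf{G3YD^\Diamond}$, and $\mathbf{Y}\oplus D^\bot\oplus D^\Diamond$ to $\mathbf{G3YD}$, for those deontic calculi listed below. Sequents $\Gamma\Rightarrow\Delta$ have $\Gamma,\Delta$ finite, possibly empty multisets; $\Box\Pi=\Box A_1,\dots,\Box A_m$ for $\Pi=A_1,\dots,A_m$. $\mathbf{G3cp}$: initial sequents $p,\Gamma\Rightarrow\Delta,p$ ($p$ a propositional variable), zero-premiss rule $L\bot$ with conclusion $\bot,\Gamma\Rightarrow\Delta$, and rules (premisses / conclusion): $L\wedge$: $A,B,\Gamma\Rightarrow\Delta$ / $A\wedge B,\Gamma\Rightarrow\Delta$; $R\wedge$: $\Gamma\Rightarrow\Delta,A$ and $\Gamma\Rightarrow\Delta,B$ / $\Gamma\Rightarrow\Delta,A\wedge B$; $L\vee$: $A,\Gamma\Rightarrow\Delta$ and $B,\Gamma\Rightarrow\Delta$ / $A\vee B,\Gamma\Rightarrow\Delta$; $R\vee$: $\Gamma\Rightarrow\Delta,A,B$ / $\Gamma\Rightarrow\Delta,A\vee B$; $L\supset$: $\Gamma\Rightarrow\Delta,A$ and $B,\Gamma\Rightarrow\Delta$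 / $A\supset B,\Gamma\Rightarrow\Delta$; $R\supset$: $A,\Gamma\Rightarrow\Delta,B$ / $\Gamma\Rightarrow\Delta,A\supset B$. Modal and deontic rules ($\Gamma,\Delta$ arbitrary): $LR$-$E$: $A\Rightarrow B$ and $B\Rightarrow A$ / $\Box A,\Gamma\Rightarrow\Delta,\Box B$; $LR$-$M$: $A\Rightarrow B$ / $\Box A,\Gamma\Rightarrow\Delta,\Box B$; $LR$-$R$: $A,\Pi\Rightarrow B$ / $\Box A,\Box\Pi,\Gamma\Rightarrow\Delta,\Box B$; $LR$-$C$ ($n\ge1$): $A_1,\dots,A_n\Rightarrow B$ and $B\Rightarrow A_1$, …, $B\Rightarrow A_n$ / $\Box A_1,\dots,\Box A_n,\Gamma\Rightarrow\Delta,\Box B$; $LR$-$K$: $\Pi\Rightarrow B$ / $\Box\Pi,\Gamma\Rightarrow\Delta,\Box B$; $R$-$N$: $\Rightarrow B$ / $\Gamma\Rightarrow\Delta,\Box B$; $L$-$D^\bot$: $A\Rightarrow$ / $\Box A,\Gamma\Rightarrow\Delta$; $L$-$D^{\Diamond_E}$ ($|\Pi|\le2$): $\Pi\Rightarrow$ and $\Rightarrow\Pi$ / $\Box\Pi,\Gamma\Rightarrow\Delta$; $L$-$D^{\Diamond_M}$ ($|\Pi|\le2$): $\Pi\Rightarrow$ / $\Box\Pi,\Gamma\Rightarrow\Delta$; $L$-$D^{\Diamond_C}$: $\Pi,\Sigma\Rightarrow$ and $\Rightarrow A,B$ for every $A\in\Pi$, $B\in\Sigma$ / $\Box\Pi,\Box\Sigma,\Gamma\Rightarrow\Delta$;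 $L$-$D^*$: $\Pi\Rightarrow$ / $\Box\Pi,\Gamma\Rightarrow\Delta$. Calculi ($\mathbf{G3cp}$ plus): $\mathbf{G3E}$: $LR$-$E$; $\mathbf{G3EN}$: $LR$-$E$, $R$-$N$; $\mathbf{G3M}$: $LR$-$M$; $\mathbf{G3MN}$: $LR$-$M$, $R$-$N$; $\mathbf{G3C}$: $LR$-$C$; $\mathbf{G3CN}$: $LR$-$C$, $R$-$N$; $\mathbf{G3R}$: $LR$-$R$; $\mathbf{G3K}$: $LR$-$K$; $\mathbf{G3ED^\bot}$ / $\mathbf{G3END^\bot}$: rules of $\mathbf{G3E}$ / $\mathbf{G3EN}$ plus $L$-$D^\bot$; $\mathbf{G3ED^\Diamond}$: $\mathbf{G3E}$ plus $L$-$D^{\Diamond_E}$; $\mathbf{G3ED}$ / $\mathbf{G3END}$: $\mathbf{G3E}$ / $\mathbf{G3EN}$ plus $L$-$D^\bot$ and $L$-$D^{\Diamond_E}$; $\mathbf{G3MD^\bot}$ / $\mathbf{G3MND^\bot}$: $\mathbf{G3M}$ / $\mathbf{G3MN}$ plus $L$-$D^\bot$; $\mathbf{G3MD}$ / $\mathbf{G3MND}$: $\mathbf{G3M}$ / $\mathbf{G3MN}$ plus $L$-$D^{\Diamond_M}$; $\mathbf{G3CD^\Diamond}$: $\mathbf{G3C}$ plus $L$-$D^{\Diamond_C}$; $\mathbf{G3CD}$, $\mathbf{G3CND}$, $\mathbf{G3RD}$, $\mathbf{G3KD}$: $\mathbf{G3C}$, $\mathbf{G3CN}$, $\mathbf{G3R}$,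 $\mathbf{G3K}$ respectively plus $L$-$D^*$. A derivation is a finite upward-growing tree of sequents whose leaves are initial sequents or conclusions of $L\bot$ and each other node is the conclusion of a rule instance whose premisses are its children. -}

module Defs where

open import Data.Nat using (ℕ; _≤_)
open import Data.Bool using (Bool; true; false; _∧_; _∨_; not)
open import Data.List using (List; []; _∷_; _++_; map; length)
open import Data.List.Membership.Propositional using (_∈_)
open import Data.List.Relation.Binary.Permutation.Propositional using (_↭_)
open import Data.Product using (Σ; _×_)
open import Relation.Binary.PropositionalEquality using (_≡_)

infixr 8 _∧'_
infixr 7 _∨'_
infixr 6 _⊃_

data Fm : Set where
  var  : ℕ → Fm
  ⊥'   : Fm
  _∧'_ : Fm → Fm → Fm
  _∨'_ : Fm → Fm → Fm
  _⊃_  : Fm → Fm → Fm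
  □    : Fm → Fm

¬' : Fm → Fm
¬' A = A ⊃ ⊥'

⊤' : Fm
⊤' = ⊥' ⊃ ⊥'

_↔_ : Fm → Fm → Fm
A ↔ B = (A ⊃ B) ∧' (B ⊃ A)

◇ : Fm → Fm
◇ A = ¬' (□ (¬' A))

data PFm : Set where
  pvar : ℕ → PFm
  p⊥   : PFm
  p∧   : PFm → PFm → PFm
  p∨   : PFm → PFm → PFm
  p⊃   : PFm → PFm → PFm

eval : (ℕ → Bool) → PFm → Bool
eval v (pvar n)  = v n
eval v p⊥        = false
eval v (p∧ A B)  = eval v A ∧ eval v B
eval v (p∨ A B)  = eval v A ∨ eval v B
eval v (p⊃ A B)  = not (eval v A) ∨ eval v B

Tautology : PFm → Set
Tautology T = (v : ℕ → Bool) → eval v T ≡ true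

inst : (ℕ → Fm) → PFm → Fm
inst σ (pvar n)  = σ n
inst σ p⊥        = ⊥'
inst σ (p∧ A B)  = inst σ A ∧' inst σ B
inst σ (p∨ A B)  = inst σ A ∨' inst σ B
inst σ (p⊃ A B)  = inst σ A ⊃ inst σ B

TautInstance : Fm → Set
TautInstance A = Σ PFm λ T → Σ (ℕ → Fm) λ σ → Tautology T × (inst σ T ≡ A)

data Calc : Set where
  E EN M MN C CN R K : Calc
  ED⊥ END⊥ ED◇ ED END : Calc
  MD⊥ MND⊥ MD MND : Calc
  CD◇ CD CND RD KD : Calc

data Scheme : Set where
  sM sC sN sD⊥ sD◇ : Scheme

schemes : Calc → List Scheme
schemes E    = []
schemes EN   = sN ∷ []
schemes M    = sM ∷ []
schemes MN   = sM ∷ sN ∷ []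
schemes C    = sC ∷ []
schemes CN   = sC ∷ sN ∷ []
schemes R    = sM ∷ sC ∷ []
schemes K    = sM ∷ sC ∷ sN ∷ []
schemes ED⊥  = sD⊥ ∷ []
schemes END⊥ = sN ∷ sD⊥ ∷ []
schemes ED◇  = sD◇ ∷ []
schemes ED   = sD⊥ ∷ sD◇ ∷ []
schemes END  = sN ∷ sD⊥ ∷ sD◇ ∷ []
schemes MD⊥  = sM ∷ sD⊥ ∷ []
schemes MND⊥ = sM ∷ sN ∷ sD⊥ ∷ []
schemes MD   = sM ∷ sD⊥ ∷ sD◇ ∷ []
schemes MND  = sM ∷ sN ∷ sD⊥ ∷ sD◇ ∷ []
schemes CD◇  = sC ∷ sD◇ ∷ []
schemes CD   = sC ∷ sD⊥ ∷ sD◇ ∷ []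
schemes CND  = sC ∷ sN ∷ sD⊥ ∷ sD◇ ∷ []
schemes RD   = sM ∷ sC ∷ sD⊥ ∷ sD◇ ∷ []
schemes KD   = sM ∷ sC ∷ sN ∷ sD⊥ ∷ sD◇ ∷ []

data Axiom (X : Calc) : Fm → Set where
  ax-taut : ∀ {A} → TautInstance A → Axiom X A
  ax-M    : ∀ {A B} → sM ∈ schemes X → Axiom X (□ (A ∧' B) ⊃ (□ A ∧' □ B))
  ax-C    : ∀ {A B} → sC ∈ schemes X → Axiom X ((□ A ∧' □ B) ⊃ □ (A ∧' B))
  ax-N    : sN ∈ schemes X → Axiom X (□ ⊤')
  ax-D⊥   : sD⊥ ∈ schemes X → Axiom X (¬' (□ ⊥'))
  ax-D◇   : ∀ {A} → sD◇ ∈ schemes X → Axiom X (□ A ⊃ ◇ A)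

data MRule : Set where
  rE rM rR rC rK rN rD⊥ rD◇E rD◇M rD◇C rD* : MRule

rules : Calc → List MRule
rules E    = rE ∷ []
rules EN   = rE ∷ rN ∷ []
rules M    = rM ∷ []
rules MN   = rM ∷ rN ∷ []
rules C    = rC ∷ []
rules CN   = rC ∷ rN ∷ []
rules R    = rR ∷ []
rules K    = rK ∷ []
rules ED⊥  = rE ∷ rD⊥ ∷ []
rules END⊥ = rE ∷ rN ∷ rD⊥ ∷ []
rules ED◇  = rE ∷ rD◇E ∷ []
rules ED   = rE ∷ rD⊥ ∷ rD◇E ∷ []
rules END  = rE ∷ rN ∷ rD⊥ ∷ rD◇E ∷ []
rules MD⊥  = rM ∷ rD⊥ ∷ []
rules MND⊥ = rM ∷ rN ∷ rD⊥ ∷ []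
rules MD   = rM ∷ rD◇M ∷ []
rules MND  = rM ∷ rN ∷ rD◇M ∷ []
rules CD◇  = rC ∷ rD◇C ∷ []
rules CD   = rC ∷ rD* ∷ []
rules CND  = rC ∷ rN ∷ rD* ∷ []
rules RD   = rR ∷ rD* ∷ []
rules KD   = rK ∷ rD* ∷ []

□s : List Fm → List Fm
□s = map □

-- Derivability in G3X.  Sequents are pairs of lists; multiset reading is
-- obtained by the rule `perm` (closure under permutation of either side).

infix 3 _⊢_⇒_

data _⊢_⇒_ (X : Calc) : List Fm → List Fm → Set where
  init : ∀ {p Γ Δ} → X ⊢ var p ∷ Γ ⇒ var p ∷ Δ
  L⊥   : ∀ {Γ Δ} → X ⊢ ⊥' ∷ Γ ⇒ Δ
  perm : ∀ {Γ Δ Γ' Δ'} → X ⊢ Γ ⇒ Δ → Γ ↭ Γ' → Δ ↭ Δ' → X ⊢ Γ' ⇒ Δ'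
  L∧   : ∀ {A B Γ Δ} → X ⊢ A ∷ B ∷ Γ ⇒ Δ → X ⊢ A ∧' B ∷ Γ ⇒ Δ
  R∧   : ∀ {A B Γ Δ} → X ⊢ Γ ⇒ A ∷ Δ → X ⊢ Γ ⇒ B ∷ Δ → X ⊢ Γ ⇒ A ∧' B ∷ Δ
  L∨   : ∀ {A B Γ Δ} → X ⊢ A ∷ Γ ⇒ Δ → X ⊢ B ∷ Γ ⇒ Δ → X ⊢ A ∨' B ∷ Γ ⇒ Δ
  R∨   : ∀ {A B Γ Δ} → X ⊢ Γ ⇒ A ∷ B ∷ Δ → X ⊢ Γ ⇒ A ∨' B ∷ Δ
  L⊃   : ∀ {A B Γ Δ} → X ⊢ Γ ⇒ A ∷ Δ → X ⊢ B ∷ Γ ⇒ Δ → X ⊢ A ⊃ B ∷ Γ ⇒ Δ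
  R⊃   : ∀ {A B Γ Δ} → X ⊢ A ∷ Γ ⇒ B ∷ Δ → X ⊢ Γ ⇒ A ⊃ B ∷ Δ
  LR-E : ∀ {A B Γ Δ} → rE ∈ rules X →
         X ⊢ A ∷ [] ⇒ B ∷ [] → X ⊢ B ∷ [] ⇒ A ∷ [] →
         X ⊢ □ A ∷ Γ ⇒ □ B ∷ Δ
  LR-M : ∀ {A B Γ Δ} → rM ∈ rules X →
         X ⊢ A ∷ [] ⇒ B ∷ [] →
         X ⊢ □ A ∷ Γ ⇒ □ B ∷ Δ
  LR-R : ∀ {A B Π Γ Δ} → rR ∈ rules X →
         X ⊢ A ∷ Π ⇒ B ∷ [] →
         X ⊢ □ A ∷ (□s Π ++ Γ) ⇒ □ B ∷ Δ
  -- n ≥ 1 : the list of principal formulas is A ∷ As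
  LR-C : ∀ {A As B Γ Δ} → rC ∈ rules X →
         X ⊢ A ∷ As ⇒ B ∷ [] →
         ((D : Fm) → D ∈ A ∷ As → X ⊢ B ∷ [] ⇒ D ∷ []) →
         X ⊢ □s (A ∷ As) ++ Γ ⇒ □ B ∷ Δ
  LR-K : ∀ {Π B Γ Δ} → rK ∈ rules X →
         X ⊢ Π ⇒ B ∷ [] →
         X ⊢ □s Π ++ Γ ⇒ □ B ∷ Δ
  R-N  : ∀ {B Γ Δ} → rN ∈ rules X →
         X ⊢ [] ⇒ B ∷ [] →
         X ⊢ Γ ⇒ □ B ∷ Δ
  L-D⊥ : ∀ {A Γ Δ} → rD⊥ ∈ rules X →
         X ⊢ A ∷ [] ⇒ [] →
         X ⊢ □ A ∷ Γ ⇒ Δ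
  L-D◇E : ∀ {Π Γ Δ} → rD◇E ∈ rules X → length Π ≤ 2 →
          X ⊢ Π ⇒ [] → X ⊢ [] ⇒ Π →
          X ⊢ □s Π ++ Γ ⇒ Δ
  L-D◇M : ∀ {Π Γ Δ} → rD◇M ∈ rules X → length Π ≤ 2 →
          X ⊢ Π ⇒ [] →
          X ⊢ □s Π ++ Γ ⇒ Δ
  -- Π and Σ nonempty: A ∷ Π and B ∷ Σ
  L-D◇C : ∀ {A Π B Σ' Γ Δ} → rD◇C ∈ rules X →
          X ⊢ (A ∷ Π) ++ (B ∷ Σ') ⇒ [] →
          ((C' : Fm) → C' ∈ A ∷ Π → (D : Fm) → D ∈ B ∷ Σ' →
             X ⊢ [] ⇒ C' ∷ D ∷ []) →
          X ⊢ □s (A ∷ Π) ++ □s (B ∷ Σ') ++ Γ ⇒ Δ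
  L-D* : ∀ {Π Γ Δ} → rD* ∈ rules X →
         X ⊢ Π ⇒ [] →
         X ⊢ □s Π ++ Γ ⇒ Δ

-- The modal schemes are handled uniformly: each scheme M, C, N, D⊥, D◇
-- corresponds to a derived rule (monotonicity, aggregation, necessitation,
-- consistency, no-conflict), and each derived rule follows from any of the
-- primitive modal rules that implement it in some calculus.  The congruence rule RE, derivable in
-- every calculus, gives identity sequents A ⇒ A for arbitrary formulas.
--
-- Instances of tautologies are handled by the usual completeness argument for
-- G3cp: a valid propositional sequent is decomposed by the (semantically
-- invertible) propositional rules until only atoms remain, and a valid atomic
-- sequent is an identity or has ⊥ on the left.  The decomposition of a single
-- formula is by structural recursion on it, passing the atoms it produces to
-- a continuation that finishes the rest of the sequent; hence no measure on
-- sequents is needed.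
module Submission where

open import Defs
open import Data.Nat using (ℕ; s≤s; z≤n)
open import Data.Nat.Properties using (_≟_)
open import Data.Bool using (Bool; true; false; T)
open import Data.Bool.Properties using (T-∧; T-∨; T-≡)
open import Data.List using (List; []; _∷_; _++_; map)
open import Data.List.Membership.Propositional using (_∈_; find)
open import Data.List.Membership.Propositional.Properties using (∈-map⁺; ∈-∃++)
open import Data.List.Membership.DecPropositional _≟_ using (_∈?_)
open import Data.List.Relation.Unary.All using (All; []; _∷_; lookup; all?)
open import Data.List.Relation.Unary.All.Properties using (¬All⇒Any¬) renaming (++⁺ to All-++⁺)
open import Data.List.Relation.Unary.Any using (Any; here; there)
open import Data.List.Relation.Unary.Any.Properties using (++⁺ˡ; ++⁺ʳ)
open import Data.List.Relation.Binary.Permutation.Propositional using (_↭_; ↭-refl; ↭-sym; swap)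
open import Data.List.Relation.Binary.Permutation.Propositional.Properties
  using (shift; ++-assoc; All-resp-↭; Any-resp-↭) renaming (map⁺ to map-↭)
open import Data.Product using (∃; _,_; proj₁; proj₂)
open import Data.Sum using (inj₁; inj₂; [_,_]′)
open import Data.Empty using (⊥-elim)
open import Function using (_∘_)
open import Function.Bundles using (Equivalence)
open import Relation.Nullary using (yes; no; ¬_)
open import Relation.Nullary.Decidable using (Dec; isYes; toWitness; fromWitness; T?)
open import Relation.Binary.PropositionalEquality using (refl)

open Equivalence using (to; from)

private
  variable
    X : Calc
    A B : Fm
    Γ Δ : List Fm
    P Q : PFm
    Θ Λ Φ Ψ : List PFm

pattern #0 = here refl
pattern #1 = there #0
pattern #2 = there #1
pattern #3 = there #2

to-front : ∀ {a} {S : Set a} {x : S} {xs : List S} → x ∈ xs → ∃ λ ys → xs ↭ x ∷ ys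
to-front x∈ with ys , zs , refl ← ∈-∃++ x∈ = ys ++ zs , shift _ ys zs

swap-front : ∀ {a} {S : Set a} {x y : S} {xs : List S} → x ∷ y ∷ xs ↭ y ∷ x ∷ xs
swap-front = swap _ _ ↭-refl

Congruence : Calc → Set
Congruence X = ∀ {A B Γ Δ} → X ⊢ A ∷ [] ⇒ B ∷ [] → X ⊢ B ∷ [] ⇒ A ∷ [] →
               X ⊢ □ A ∷ Γ ⇒ □ B ∷ Δ

Monotonicity : Calc → Set
Monotonicity X = ∀ {A B Γ Δ} → X ⊢ A ∷ [] ⇒ B ∷ [] → X ⊢ □ A ∷ Γ ⇒ □ B ∷ Δ

Aggregation : Calc → Set
Aggregation X = ∀ {A B C Γ Δ} → X ⊢ A ∷ B ∷ [] ⇒ C ∷ [] →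
                X ⊢ C ∷ [] ⇒ A ∷ [] → X ⊢ C ∷ [] ⇒ B ∷ [] →
                X ⊢ □ A ∷ □ B ∷ Γ ⇒ □ C ∷ Δ

Necessitation : Calc → Set
Necessitation X = ∀ {B Γ Δ} → X ⊢ [] ⇒ B ∷ [] → X ⊢ Γ ⇒ □ B ∷ Δ

Consistency : Calc → Set
Consistency X = ∀ {A Γ Δ} → X ⊢ A ∷ [] ⇒ [] → X ⊢ □ A ∷ Γ ⇒ Δ

NoConflict : Calc → Set
NoConflict X = ∀ {A B Γ Δ} → X ⊢ A ∷ B ∷ [] ⇒ [] → X ⊢ [] ⇒ A ∷ B ∷ [] →
               X ⊢ □ A ∷ □ B ∷ Γ ⇒ Δ

SchemeRule : Scheme → Calc → Set
SchemeRule sM  = Monotonicity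
SchemeRule sC  = Aggregation
SchemeRule sN  = Necessitation
SchemeRule sD⊥ = Consistency
SchemeRule sD◇ = NoConflict

congruence-E : rE ∈ rules X → Congruence X
congruence-E r = LR-E r

congruence-C : rC ∈ rules X → Congruence X
congruence-C r ab ba = LR-C {As = []} r ab (λ _ → lookup (ba ∷ []))

monotone⇒congruence : Monotonicity X → Congruence X
monotone⇒congruence mono ab _ = mono ab

monotonicity-M : rM ∈ rules X → Monotonicity X
monotonicity-M r = LR-M r

monotonicity-R : rR ∈ rules X → Monotonicity X
monotonicity-R r = LR-R {Π = []} r

monotonicity-K : rK ∈ rules X → Monotonicity X
monotonicity-K r = LR-K {Π = _ ∷ []} r

aggregation-C : rC ∈ rules X → Aggregation X
aggregation-C r ab ca cb = LR-C {As = _ ∷ []} r ab (λ _ → lookup (ca ∷ cb ∷ []))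

aggregation-R : rR ∈ rules X → Aggregation X
aggregation-R r ab _ _ = LR-R {Π = _ ∷ []} r ab

aggregation-K : rK ∈ rules X → Aggregation X
aggregation-K r ab _ _ = LR-K {Π = _ ∷ _ ∷ []} r ab

necessitation-N : rN ∈ rules X → Necessitation X
necessitation-N r = R-N r

necessitation-K : rK ∈ rules X → Necessitation X
necessitation-K r = LR-K {Π = []} r

consistency-D⊥ : rD⊥ ∈ rules X → Consistency X
consistency-D⊥ r = L-D⊥ r

consistency-D◇M : rD◇M ∈ rules X → Consistency X
consistency-D◇M r = L-D◇M {Π = _ ∷ []} r (s≤s z≤n)

consistency-D* : rD* ∈ rules X → Consistency X
consistency-D* r = L-D* {Π = _ ∷ []} r

noConflict-D◇E : rD◇E ∈ rules X → NoConflict X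
noConflict-D◇E r = L-D◇E {Π = _ ∷ _ ∷ []} r (s≤s (s≤s z≤n))

noConflict-D◇M : rD◇M ∈ rules X → NoConflict X
noConflict-D◇M r incompatible _ = L-D◇M {Π = _ ∷ _ ∷ []} r (s≤s (s≤s z≤n)) incompatible

noConflict-D◇C : rD◇C ∈ rules X → NoConflict X
noConflict-D◇C r incompatible exhaustive =
  L-D◇C {Π = []} {Σ' = []} r incompatible
    (λ { _ (here refl) _ (here refl) → exhaustive })

noConflict-D* : rD* ∈ rules X → NoConflict X
noConflict-D* r incompatible _ = L-D* {Π = _ ∷ _ ∷ []} r incompatible

congruence : ∀ X → Congruence X
congruence E    = congruence-E #0
congruence EN   = congruence-E #0
congruence M    = monotone⇒congruence (monotonicity-M #0)
congruence MN   = monotone⇒congruence (monotonicity-M #0)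
congruence C    = congruence-C #0
congruence CN   = congruence-C #0
congruence R    = monotone⇒congruence (monotonicity-R #0)
congruence K    = monotone⇒congruence (monotonicity-K #0)
congruence ED⊥  = congruence-E #0
congruence END⊥ = congruence-E #0
congruence ED◇  = congruence-E #0
congruence ED   = congruence-E #0
congruence END  = congruence-E #0
congruence MD⊥  = monotone⇒congruence (monotonicity-M #0)
congruence MND⊥ = monotone⇒congruence (monotonicity-M #0)
congruence MD   = monotone⇒congruence (monotonicity-M #0)
congruence MND  = monotone⇒congruence (monotonicity-M #0)
congruence CD◇  = congruence-C #0
congruence CD   = congruence-C #0
congruence CND  = congruence-C #0
congruence RD   = monotone⇒congruence (monotonicity-R #0)
congruence KD   = monotone⇒congruence (monotonicity-K #0)

admissible : ∀ X → All (λ s → SchemeRule s X) (schemes X)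
admissible E    = []
admissible EN   = necessitation-N #1 ∷ []
admissible M    = monotonicity-M #0 ∷ []
admissible MN   = monotonicity-M #0 ∷ necessitation-N #1 ∷ []
admissible C    = aggregation-C #0 ∷ []
admissible CN   = aggregation-C #0 ∷ necessitation-N #1 ∷ []
admissible R    = monotonicity-R #0 ∷ aggregation-R #0 ∷ []
admissible K    = monotonicity-K #0 ∷ aggregation-K #0 ∷ necessitation-K #0 ∷ []
admissible ED⊥  = consistency-D⊥ #1 ∷ []
admissible END⊥ = necessitation-N #1 ∷ consistency-D⊥ #2 ∷ []
admissible ED◇  = noConflict-D◇E #1 ∷ []
admissible ED   = consistency-D⊥ #1 ∷ noConflict-D◇E #2 ∷ []
admissible END  = necessitation-N #1 ∷ consistency-D⊥ #2 ∷ noConflict-D◇E #3 ∷ []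
admissible MD⊥  = monotonicity-M #0 ∷ consistency-D⊥ #1 ∷ []
admissible MND⊥ = monotonicity-M #0 ∷ necessitation-N #1 ∷ consistency-D⊥ #2 ∷ []
admissible MD   = monotonicity-M #0 ∷ consistency-D◇M #1 ∷ noConflict-D◇M #1 ∷ []
admissible MND  = monotonicity-M #0 ∷ necessitation-N #1 ∷ consistency-D◇M #2 ∷ noConflict-D◇M #2 ∷ []
admissible CD◇  = aggregation-C #0 ∷ noConflict-D◇C #1 ∷ []
admissible CD   = aggregation-C #0 ∷ consistency-D* #1 ∷ noConflict-D* #1 ∷ []
admissible CND  = aggregation-C #0 ∷ necessitation-N #1 ∷ consistency-D* #2 ∷ noConflict-D* #2 ∷ []
admissible RD   = monotonicity-R #0 ∷ aggregation-R #0 ∷ consistency-D* #1 ∷ noConflict-D* #1 ∷ []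
admissible KD   =
  monotonicity-K #0 ∷ aggregation-K #0 ∷ necessitation-K #0 ∷ consistency-D* #1 ∷ noConflict-D* #1 ∷ []

identity : ∀ X A → X ⊢ A ∷ Γ ⇒ A ∷ Δ
identity X (var p)  = init
identity X ⊥'       = L⊥
identity X (A ∧' B) = L∧ (R∧ (identity X A) (perm (identity X B) swap-front ↭-refl))
identity X (A ∨' B) = R∨ (L∨ (identity X A) (perm (identity X B) ↭-refl swap-front))
identity X (A ⊃ B)  = R⊃ (perm (L⊃ (identity X A) (identity X B)) swap-front ↭-refl)
identity X (□ A)    = congruence X (identity X A) (identity X A)

identity-∈ : A ∈ Γ → A ∈ Δ → X ⊢ Γ ⇒ Δ
identity-∈ {X = X} A∈Γ A∈Δ with _ , Γ↭ ← to-front A∈Γ | _ , Δ↭ ← to-front A∈Δ =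
  perm (identity X _) (↭-sym Γ↭) (↭-sym Δ↭)

⊥-∈ : ⊥' ∈ Γ → X ⊢ Γ ⇒ Δ
⊥-∈ ⊥∈Γ with _ , Γ↭ ← to-front ⊥∈Γ = perm L⊥ (↭-sym Γ↭) ↭-refl

axiom-M : Monotonicity X → X ⊢ [] ⇒ (□ (A ∧' B) ⊃ (□ A ∧' □ B)) ∷ []
axiom-M mono = R⊃ (R∧ (mono (L∧ (identity-∈ #0 #0))) (mono (L∧ (identity-∈ #1 #0))))

axiom-C : Aggregation X → X ⊢ [] ⇒ ((□ A ∧' □ B) ⊃ □ (A ∧' B)) ∷ []
axiom-C aggr =
  R⊃ (L∧ (aggr (R∧ (identity-∈ #0 #0) (identity-∈ #1 #0))
                (L∧ (identity-∈ #0 #0))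
                (L∧ (identity-∈ #1 #0))))

axiom-N : Necessitation X → X ⊢ [] ⇒ □ ⊤' ∷ []
axiom-N nec = nec (R⊃ L⊥)

axiom-D⊥ : Consistency X → X ⊢ [] ⇒ ¬' (□ ⊥') ∷ []
axiom-D⊥ cons = R⊃ (cons L⊥)

-- □A, □¬A ⇒ follows since ¬A and A are incompatible and jointly exhaustive.
axiom-D◇ : NoConflict X → X ⊢ [] ⇒ (□ A ⊃ ◇ A) ∷ []
axiom-D◇ noConflict =
  R⊃ (R⊃ (noConflict (L⊃ (identity-∈ #0 #0) L⊥) (R⊃ (identity-∈ #0 #1))))

Holds : (ℕ → Bool) → PFm → Set
Holds v A = T (eval v A)

Valid : List PFm → List PFm → Set
Valid Γ Δ = ∀ v → All (Holds v) Γ → Any (Holds v) Δ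

holds? : ∀ v P → Dec (Holds v P)
holds? v P = T? (eval v P)

⊃-intro : ∀ v A B → (Holds v A → Holds v B) → Holds v (p⊃ A B)
⊃-intro v A B f with eval v A
... | true  = f _
... | false = _

⊃-elim : ∀ v A B → Holds v (p⊃ A B) → Holds v A → Holds v B
⊃-elim v A B h a with eval v A
... | true = h

replace-head : ∀ {v C} {Φ Ψ : List PFm} → (Holds v C → Any (Holds v) Φ) →
               Any (Holds v) (C ∷ Ψ) → Any (Holds v) (Φ ++ Ψ)
replace-head f (here h)   = ++⁺ˡ (f h)
replace-head {Φ = Φ} f (there h) = ++⁺ʳ Φ h

data Atomic : PFm → Set where
  var : ∀ {k} → Atomic (pvar k)
  bot : Atomic p⊥

varsOf : All Atomic Θ → List ℕ
varsOf []              = []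
varsOf (var {k} ∷ ats) = k ∷ varsOf ats
varsOf (bot ∷ ats)     = varsOf ats

varsOf-sound : ∀ {k} (ats : All Atomic Θ) → k ∈ varsOf ats → pvar k ∈ Θ
varsOf-sound (var ∷ ats) (here refl) = here refl
varsOf-sound (var ∷ ats) (there k∈)  = there (varsOf-sound ats k∈)
varsOf-sound (bot ∷ ats) k∈          = there (varsOf-sound ats k∈)

varsOf-complete : ∀ {k} (ats : All Atomic Θ) → pvar k ∈ Θ → k ∈ varsOf ats
varsOf-complete (var ∷ ats) (here refl) = here refl
varsOf-complete (var ∷ ats) (there k∈)  = there (varsOf-complete ats k∈)
varsOf-complete (bot ∷ ats) (there k∈)  = varsOf-complete ats k∈

canonical : All Atomic Θ → ℕ → Bool
canonical ats k = isYes (k ∈? varsOf ats)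

module Completeness (X : Calc) (σ : ℕ → Fm) where

  Derivable : List PFm → List PFm → Set
  Derivable Γ Δ = X ⊢ map (inst σ) Γ ⇒ map (inst σ) Δ

  Complete : List PFm → List PFm → Set
  Complete Γ Δ = Valid Γ Δ → Derivable Γ Δ

  complete-↭ : Θ ↭ Φ → Λ ↭ Ψ → Complete Θ Λ → Complete Φ Ψ
  complete-↭ Θ↭ Λ↭ c valid =
    perm (c λ v hs → Any-resp-↭ (↭-sym Λ↭) (valid v (All-resp-↭ Θ↭ hs)))
         (map-↭ (inst σ) Θ↭) (map-↭ (inst σ) Λ↭)

  -- Each propositional rule preserves completeness: validity of its
  -- conclusion implies validity of its premisses.

  complete-L∧ : Complete (P ∷ Q ∷ Θ) Λ → Complete (p∧ P Q ∷ Θ) Λ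
  complete-L∧ c valid = L∧ (c λ v → λ { (p ∷ q ∷ hs) → valid v (from T-∧ (p , q) ∷ hs) })

  complete-L∨ : Complete (P ∷ Θ) Λ → Complete (Q ∷ Θ) Λ → Complete (p∨ P Q ∷ Θ) Λ
  complete-L∨ cP cQ valid =
    L∨ (cP λ v → λ { (p ∷ hs) → valid v (from T-∨ (inj₁ p) ∷ hs) })
       (cQ λ v → λ { (q ∷ hs) → valid v (from T-∨ (inj₂ q) ∷ hs) })

  complete-L⊃ : Complete Θ (P ∷ Λ) → Complete (Q ∷ Θ) Λ → Complete (p⊃ P Q ∷ Θ) Λ
  complete-L⊃ {Θ = Θ} {P = P} {Λ = Λ} {Q = Q} cP cQ valid =
    L⊃ (cP antecedent) (cQ λ v → λ { (q ∷ hs) → valid v (⊃-intro v P Q (λ _ → q) ∷ hs) })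
    where
    antecedent : Valid Θ (P ∷ Λ)
    antecedent v hs with holds? v P
    ... | yes p  = here p
    ... | no ¬p = there (valid v (⊃-intro v P Q (⊥-elim ∘ ¬p) ∷ hs))

  complete-R∧ : Complete Θ (P ∷ Λ) → Complete Θ (Q ∷ Λ) → Complete Θ (p∧ P Q ∷ Λ)
  complete-R∧ {P = P} {Q = Q} cP cQ valid =
    R∧ (cP λ v hs → replace-head {Φ = P ∷ []} (here ∘ proj₁ ∘ to T-∧) (valid v hs))
       (cQ λ v hs → replace-head {Φ = Q ∷ []} (here ∘ proj₂ ∘ to T-∧) (valid v hs))

  complete-R∨ : Complete Θ (P ∷ Q ∷ Λ) → Complete Θ (p∨ P Q ∷ Λ)
  complete-R∨ {P = P} {Q = Q} c valid =
    R∨ (c λ v hs → replace-head {Φ = P ∷ Q ∷ []} ([ here , there ∘ here ]′ ∘ to T-∨) (valid v hs))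

  complete-R⊃ : Complete (P ∷ Θ) (Q ∷ Λ) → Complete Θ (p⊃ P Q ∷ Λ)
  complete-R⊃ {P = P} {Q = Q} c valid =
    R⊃ (c λ v → λ { (p ∷ hs) →
      replace-head {Φ = Q ∷ []} (λ h → here (⊃-elim v P Q h p)) (valid v hs) })

  -- An antecedent atom false under the canonical valuation must be ⊥.
  falsified-antecedent : (ats : All Atomic Θ) → P ∈ Θ → ¬ Holds (canonical ats) P →
                         Derivable Θ Λ
  falsified-antecedent ats P∈ ¬h with lookup ats P∈
  ... | var = ⊥-elim (¬h (fromWitness (varsOf-complete ats P∈)))
  ... | bot = ⊥-∈ (∈-map⁺ (inst σ) P∈)

  -- A succedent atom true under the canonical valuation also occurs in Θ.
  satisfied-succedent : (ats : All Atomic Θ) → All Atomic Λ → P ∈ Λ →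
                        Holds (canonical ats) P → Derivable Θ Λ
  satisfied-succedent ats atΛ P∈ h with lookup atΛ P∈
  ... | var = identity-∈ (∈-map⁺ (inst σ) (varsOf-sound ats (toWitness h))) (∈-map⁺ (inst σ) P∈)

  complete-atomic : All Atomic Θ → All Atomic Λ → Complete Θ Λ
  complete-atomic {Θ = Θ} atΘ atΛ valid with all? (holds? (canonical atΘ)) Θ
  ... | yes holds with _ , P∈ , h ← find (valid (canonical atΘ) holds) =
    satisfied-succedent atΘ atΛ P∈ h
  ... | no fails with _ , P∈ , ¬h ← find (¬All⇒Any¬ (holds? (canonical atΘ)) Θ fails) =
    falsified-antecedent atΘ P∈ ¬h

  UpToAtoms : List PFm → List PFm → Set
  UpToAtoms Θ Λ = ∀ {Φ Ψ} → All Atomic Φ → All Atomic Ψ → Complete (Φ ++ Θ) (Ψ ++ Λ)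

  extend : All Atomic Φ → All Atomic Ψ → UpToAtoms Θ Λ → UpToAtoms (Φ ++ Θ) (Ψ ++ Λ)
  extend {Φ = Φ} {Ψ = Ψ} {Θ = Θ} {Λ = Λ} atΦ atΨ finish {Φ'} {Ψ'} atΦ' atΨ' =
    complete-↭ (++-assoc Φ' Φ Θ) (++-assoc Ψ' Ψ Λ) (finish (All-++⁺ atΦ' atΦ) (All-++⁺ atΨ' atΨ))

  to-front-L : Complete (P ∷ Φ ++ Θ) Λ → Complete (Φ ++ P ∷ Θ) Λ
  to-front-L {P = P} {Φ = Φ} {Θ = Θ} = complete-↭ (↭-sym (shift P Φ Θ)) ↭-refl

  to-front-R : Complete Θ (P ∷ Ψ ++ Λ) → Complete Θ (Ψ ++ P ∷ Λ)
  to-front-R {P = P} {Ψ = Ψ} {Λ = Λ} = complete-↭ ↭-refl (↭-sym (shift P Ψ Λ))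

  decompose-L : ∀ P → UpToAtoms Θ Λ → Complete (P ∷ Θ) Λ
  decompose-R : ∀ P → UpToAtoms Θ Λ → Complete Θ (P ∷ Λ)

  decompose-L (pvar n)  finish = finish (var ∷ []) []
  decompose-L p⊥        finish = finish (bot ∷ []) []
  decompose-L (p∧ P Q)  finish =
    complete-L∧ (decompose-L P λ a b → to-front-L (decompose-L Q (extend a b finish)))
  decompose-L (p∨ P Q)  finish = complete-L∨ (decompose-L P finish) (decompose-L Q finish)
  decompose-L (p⊃ P Q)  finish = complete-L⊃ (decompose-R P finish) (decompose-L Q finish)

  decompose-R (pvar n)  finish = finish [] (var ∷ [])
  decompose-R p⊥        finish = finish [] (bot ∷ [])
  decompose-R (p∧ P Q)  finish = complete-R∧ (decompose-R P finish) (decompose-R Q finish)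
  decompose-R (p∨ P Q)  finish =
    complete-R∨ (decompose-R P λ a b → to-front-R (decompose-R Q (extend a b finish)))
  decompose-R (p⊃ P Q)  finish =
    complete-R⊃ (decompose-L P λ a b → to-front-R (decompose-R Q (extend a b finish)))

  complete : ∀ Θ Λ → UpToAtoms Θ Λ
  complete []      []      a b = complete-atomic (All-++⁺ a []) (All-++⁺ b [])
  complete (P ∷ Θ) Λ       a b = to-front-L (decompose-L P (extend a b (complete Θ Λ)))
  complete []      (P ∷ Λ) a b = to-front-R (decompose-R P (extend a b (complete [] Λ)))

  tautology : ∀ T → Tautology T → X ⊢ [] ⇒ inst σ T ∷ []
  tautology T taut = complete [] (T ∷ []) [] [] λ v _ → here (from T-≡ (taut v))

lemma3 : (X : Calc) (A : Fm) → Axiom X A → X ⊢ [] ⇒ A ∷ []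
lemma3 X A (ax-taut (T , σ , taut , refl)) = Completeness.tautology X σ T taut
lemma3 X _ (ax-M s)  = axiom-M (lookup (admissible X) s)
lemma3 X _ (ax-C s)  = axiom-C (lookup (admissible X) s)
lemma3 X _ (ax-N s)  = axiom-N (lookup (admissible X) s)
lemma3 X _ (ax-D⊥ s) = axiom-D⊥ (lookup (admissible X) s)
lemma3 X _ (ax-D◇ s) = axiom-D◇ (lookup (admissible X) s)
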